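{- Let $a,b,c$ be integers with $2\le a\le b\le c$ and $c\ge a+b+1$. Then $F(a)^2+F(b)^2+F(c)^2-3F(a)F(b)F(c)>0$.
   Context: $F(n)$ denotes the $n$-th Fibonacci number, $F(0)=0$, $F(1)=1$, $F(n+1)=F(n)+F(n-1)$. -}

module Defs where

open import Data.Nat using (ℕ; zero; suc; _+_)

F : ℕ → ℕ
F zero = 0
F (suc zero) = 1
F (suc (suc n)) = F (suc n) + F n

-- F(m + n + 1) = F(m + 1) F(n + 1) + F(m) F(n) together with 3 F(n) ≤ 2 F(n + 1) for n ≥ 2 gives
-- 3 F(a) F(b) ≤ F(a + b + 1) ≤ F(c).  Writing x, y, z for F(a), F(b), F(c), the form equals
-- x² + y² + z (z - 3xy), whose last term is therefore nonnegative, while x² ≥ 1.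
{-# OPTIONS --safe #-}
module Submission where

open import Defs
open import Data.Nat using (ℕ; _≤_)
open import Data.Integer using (ℤ; +_; _+_; _-_; _*_; _>_)
open import Data.Nat using (zero; suc; _≤′_; ≤′-refl; ≤′-step)
open import Relation.Binary.PropositionalEquality
import Data.Nat as ℕ
import Data.Nat.Properties as ℕ
import Data.Nat.Tactic.RingSolver as ℕ-Solver
import Data.Integer as ℤ
import Data.Integer.Properties as ℤ
import Data.Integer.Tactic.RingSolver as ℤ-Solver

F-≤-suc : ∀ n → F n ≤ F (suc n)
F-≤-suc zero = ℕ.z≤n
F-≤-suc (suc zero) = ℕ.≤-refl
F-≤-suc (suc (suc n)) = ℕ.m≤m+n _ _

F-mono-≤′ : ∀ {m n} → m ≤′ n → F m ≤ F n
F-mono-≤′ ≤′-refl = ℕ.≤-refl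
F-mono-≤′ {n = suc n} (≤′-step m≤′n) = ℕ.≤-trans (F-mono-≤′ m≤′n) (F-≤-suc n)

F-mono-≤ : ∀ {m n} → m ≤ n → F m ≤ F n
F-mono-≤ m≤n = F-mono-≤′ (ℕ.≤⇒≤′ m≤n)

F-suc-+ : ∀ m n → F (suc (m ℕ.+ n)) ≡ F (suc m) ℕ.* F (suc n) ℕ.+ F m ℕ.* F n
F-suc-+ zero n = sym (trans (ℕ.+-identityʳ _) (ℕ.+-identityʳ _))
F-suc-+ (suc zero) n = cong₂ ℕ._+_ (sym (ℕ.*-identityˡ (F (suc n)))) (sym (ℕ.*-identityˡ (F n)))
F-suc-+ (suc (suc m)) n = begin
  F (suc (suc m ℕ.+ n)) ℕ.+ F (suc m ℕ.+ n)
    ≡⟨ cong₂ ℕ._+_ (F-suc-+ (suc m) n) (F-suc-+ m n) ⟩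
  (F₂ ℕ.* F (suc n) ℕ.+ F₁ ℕ.* F n) ℕ.+ (F₁ ℕ.* F (suc n) ℕ.+ F₀ ℕ.* F n)
    ≡⟨ regroup F₂ F₁ F₀ (F (suc n)) (F n) ⟩
  (F₂ ℕ.+ F₁) ℕ.* F (suc n) ℕ.+ (F₁ ℕ.+ F₀) ℕ.* F n ∎
  where
  open ≡-Reasoning
  F₂ = F (suc (suc m))
  F₁ = F (suc m)
  F₀ = F m
  regroup : ∀ a b c d e →
    (a ℕ.* d ℕ.+ b ℕ.* e) ℕ.+ (b ℕ.* d ℕ.+ c ℕ.* e) ≡ (a ℕ.+ b) ℕ.* d ℕ.+ (b ℕ.+ c) ℕ.* e
  regroup = ℕ-Solver.solve-∀

3*F≤2*F-suc : ∀ {n} → 2 ≤ n → 3 ℕ.* F n ≤ 2 ℕ.* F (suc n)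
3*F≤2*F-suc {suc (suc k)} (ℕ.s≤s (ℕ.s≤s _)) = begin
  F n ℕ.+ 2 ℕ.* F n             ≤⟨ ℕ.+-monoˡ-≤ (2 ℕ.* F n) Fn≤2*F[1+k] ⟩
  2 ℕ.* F (suc k) ℕ.+ 2 ℕ.* F n ≡⟨ ℕ.*-distribˡ-+ 2 (F (suc k)) (F n) ⟨
  2 ℕ.* (F (suc k) ℕ.+ F n)     ≡⟨ cong (2 ℕ.*_) (ℕ.+-comm (F (suc k)) (F n)) ⟩
  2 ℕ.* F (suc n)               ∎
  where
  open ℕ.≤-Reasoning
  n = suc (suc k)
  Fn≤2*F[1+k] : F n ≤ 2 ℕ.* F (suc k)
  Fn≤2*F[1+k] = begin
    F (suc k) ℕ.+ F k        ≤⟨ ℕ.+-monoʳ-≤ (F (suc k)) (F-≤-suc k) ⟩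
    F (suc k) ℕ.+ F (suc k)  ≡⟨ cong (F (suc k) ℕ.+_) (ℕ.+-identityʳ (F (suc k))) ⟨
    2 ℕ.* F (suc k)          ∎

3*F*F≤F-suc-+ : ∀ {m n} → 2 ≤ m → 2 ≤ n → 3 ℕ.* F m ℕ.* F n ≤ F (suc (m ℕ.+ n))
3*F*F≤F-suc-+ {m} {n} 2≤m 2≤n = ℕ.*-cancelˡ-≤ 4 (begin
  4 ℕ.* (3 ℕ.* x ℕ.* y)
    ≡⟨ split x y ⟩
  (3 ℕ.* x) ℕ.* (3 ℕ.* y) ℕ.+ 3 ℕ.* (x ℕ.* y)
    ≤⟨ ℕ.+-mono-≤ (ℕ.*-mono-≤ (3*F≤2*F-suc 2≤m) (3*F≤2*F-suc 2≤n)) (ℕ.*-monoˡ-≤ (x ℕ.* y) (ℕ.n≤1+n 3)) ⟩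
  (2 ℕ.* x′) ℕ.* (2 ℕ.* y′) ℕ.+ 4 ℕ.* (x ℕ.* y)
    ≡⟨ merge x′ y′ (x ℕ.* y) ⟩
  4 ℕ.* (x′ ℕ.* y′ ℕ.+ x ℕ.* y)
    ≡⟨ cong (4 ℕ.*_) (F-suc-+ m n) ⟨
  4 ℕ.* F (suc (m ℕ.+ n)) ∎)
  where
  open ℕ.≤-Reasoning
  x = F m
  y = F n
  x′ = F (suc m)
  y′ = F (suc n)
  split : ∀ x y → 4 ℕ.* (3 ℕ.* x ℕ.* y) ≡ (3 ℕ.* x) ℕ.* (3 ℕ.* y) ℕ.+ 3 ℕ.* (x ℕ.* y)
  split = ℕ-Solver.solve-∀
  merge : ∀ a b c → (2 ℕ.* a) ℕ.* (2 ℕ.* b) ℕ.+ 4 ℕ.* c ≡ 4 ℕ.* (a ℕ.* b ℕ.+ c)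
  merge = ℕ-Solver.solve-∀

markovForm : ℤ → ℤ → ℤ → ℤ
markovForm x y z = x * x + y * y + z * z - (+ 3) * x * y * z

markovForm-pos : ∀ {x y z} → 1 ≤ x → 3 ℕ.* x ℕ.* y ≤ z → markovForm (+ x) (+ y) (+ z) > + 0
markovForm-pos {x} {y} {z} 1≤x t≤z = subst (_> + 0) (sym markovForm≡+s) (ℤ.+<+ 0<s)
  where
  open ≡-Reasoning
  t = 3 ℕ.* x ℕ.* y
  d = z ℕ.∸ t
  s = x ℕ.* x ℕ.+ y ℕ.* y ℕ.+ z ℕ.* d
  X = + x
  Y = + y
  Z = + z
  complete : ∀ x y z → x * x + y * y + z * z - (+ 3) * x * y * z ≡ x * x + y * y + z * (z - (+ 3) * x * y)
  complete = ℤ-Solver.solve-∀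
  +t≡3XY : + t ≡ (+ 3) * X * Y
  +t≡3XY = trans (ℤ.pos-* (3 ℕ.* x) y) (cong (_* Y) (ℤ.pos-* 3 x))
  markovForm≡+s : markovForm X Y Z ≡ + s
  markovForm≡+s = begin
    markovForm X Y Z
      ≡⟨ complete X Y Z ⟩
    X * X + Y * Y + Z * (Z - (+ 3) * X * Y)
      ≡⟨ cong (λ u → X * X + Y * Y + Z * (Z - u)) +t≡3XY ⟨
    X * X + Y * Y + Z * (Z - + t)
      ≡⟨ cong (λ u → X * X + Y * Y + Z * u) (trans (ℤ.m-n≡m⊖n z t) (ℤ.⊖-≥ t≤z)) ⟩
    X * X + Y * Y + Z * + d
      ≡⟨ cong₂ _+_ (cong₂ _+_ (ℤ.pos-* x x) (ℤ.pos-* y y)) (ℤ.pos-* z d) ⟨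
    + (x ℕ.* x) + + (y ℕ.* y) + + (z ℕ.* d)
      ≡⟨ cong (_+ + (z ℕ.* d)) (ℤ.pos-+ (x ℕ.* x) (y ℕ.* y)) ⟨
    + (x ℕ.* x ℕ.+ y ℕ.* y) + + (z ℕ.* d)
      ≡⟨ ℤ.pos-+ (x ℕ.* x ℕ.+ y ℕ.* y) (z ℕ.* d) ⟨
    + s ∎
  0<s : 0 ℕ.< s
  0<s = ℕ.≤-trans (ℕ.*-mono-≤ 1≤x 1≤x) (ℕ.≤-trans (ℕ.m≤m+n _ _) (ℕ.m≤m+n _ _))

-- The hypothesis b ≤ c is implied by a + b + 1 ≤ c.
lemma3p1 : (a b c : ℕ) → 2 ≤ a → a ≤ b → b ≤ c → a Data.Nat.+ b Data.Nat.+ 1 ≤ c →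
    (+ F a) * (+ F a) + (+ F b) * (+ F b) + (+ F c) * (+ F c)
      - (+ 3) * (+ F a) * (+ F b) * (+ F c) > + 0
lemma3p1 a b c 2≤a a≤b _ a+b+1≤c = markovForm-pos 1≤Fa (ℕ.≤-trans 3FaFb≤F[a+b+1] F[a+b+1]≤Fc)
  where
  1≤Fa : 1 ≤ F a
  1≤Fa = F-mono-≤ (ℕ.≤-trans (ℕ.s≤s ℕ.z≤n) 2≤a)
  3FaFb≤F[a+b+1] : 3 ℕ.* F a ℕ.* F b ≤ F (suc (a ℕ.+ b))
  3FaFb≤F[a+b+1] = 3*F*F≤F-suc-+ 2≤a (ℕ.≤-trans 2≤a a≤b)
  F[a+b+1]≤Fc : F (suc (a ℕ.+ b)) ≤ F c
  F[a+b+1]≤Fc = F-mono-≤ (subst (_≤ c) (ℕ.+-comm (a ℕ.+ b) 1) a+b+1≤c)
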